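{- Let $n$ be an even nonnegative integer. Then the continuant of the sequence of run lengths of the binary representation of $n$ is equal to the continuant of the sequence of run lengths of the binary representation of $n+1$.
   Context: The binary representation of a positive integer $n$ is its base-$2$ digit string without leading zeros (so it begins with $1$); for $n=0$ it is the empty string. The run lengths of a string of $0$'s and $1$'s are the lengths of its maximal blocks of consecutive identical symbols, read from left to right (e.g. $111000011111$ has run lengths $(3,4,5)$). The continuant of a sequence $(m_0,\ldots,m_k)$ of positive integers is the numerator of the continued fraction $[m_0;m_1,\ldots,m_k]$; equivalently it is $K(m_0,\ldots,m_k)$ defined by $K()=1$, $K(m_0)=m_0$, and $K(m_0,\ldots,m_k)=m_kK(m_0,\ldots,m_{k-1})+K(m_0,\ldots,m_{k-2})$ for $k\ge1$. -}

module Defs where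

open import Data.Nat using (ℕ; zero; suc; _+_; _*_; _/_; _%_; _≡ᵇ_)
open import Data.Bool using (Bool; true; false; _∧_; not)
open import Data.List using (List; []; _∷_; _++_; [_]; reverse)

-- Little-endian bit list of m, computed with fuel (fuel ≥ m suffices,
-- since m / 2 < m for m ≥ 1).  Bit is true iff digit is 1.
bitsLE : (fuel m : ℕ) → List Bool
bitsLE zero    m = []
bitsLE (suc f) zero = []
bitsLE (suc f) (suc m) = ((suc m % 2) ≡ᵇ 1) ∷ bitsLE f (suc m / 2)

-- Binary representation of n: most significant digit first, no leading
-- zeros; empty for n = 0.
binary : ℕ → List Bool
binary n = reverse (bitsLE n n)

_==_ : Bool → Bool → Bool
true  == b = b
false == b = not b

-- Run lengths of a bit string, left to right.
-- runsAux b k xs: current run of symbol b has length k so far (k ≥ 1).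
runsAux : Bool → ℕ → List Bool → List ℕ
runsAux b k []       = k ∷ []
runsAux b k (x ∷ xs) with b == x
... | true  = runsAux b (suc k) xs
... | false = k ∷ runsAux x 1 xs

runLengths : List Bool → List ℕ
runLengths []       = []
runLengths (x ∷ xs) = runsAux x 1 xs

-- Continuant K(m₀,…,m_k) via the recurrence, computed left to right:
-- contAux p q xs with p = K(prefix), q = K(prefix minus last element).
contAux : ℕ → ℕ → List ℕ → ℕ
contAux p q []       = p
contAux p q (m ∷ ms) = contAux (m * p + q) p ms

-- K() = 1, K(m₀) = m₀ (= m₀·1 + 0), K(…,m_k) = m_k K(…,m_{k-1}) + K(…,m_{k-2}).
continuant : List ℕ → ℕ
continuant ms = contAux 1 0 ms

-- Appending a bit b to a string ending in a run of length j gives final run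
-- j + 1, while appending not b gives final runs j, 1.  The continuant does not
-- see the difference, since K(…, j + 1) = K(…, j, 1), i.e. [a; …, j + 1] =
-- [a; …, j, 1].  The binary strings of 2k and 2k + 1 are those of k followed
-- by 0 and by 1 respectively.
module Submission where

open import Defs
open import Data.Nat using (ℕ; _+_; _*_)
open import Relation.Binary.PropositionalEquality using (_≡_)

open import Data.Nat using (zero; suc; _≤_; _/_; _%_; _≡ᵇ_; z≤n; s≤s)
open import Data.Nat.Properties using (≤-refl; ≤-trans; *-comm; +-comm)
open import Data.Nat.DivMod using (m/n<m; m*n/n≡m; m*n%n≡0; +-distrib-/-∣ʳ; [m+kn]%n≡m%n)
open import Data.Nat.Divisibility using (divides-refl)
open import Data.Nat.Tactic.RingSolver using (solve-∀)
open import Data.Bool using (Bool; true; false; not)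
open import Data.List using (List; []; _∷_; _++_; [_]; reverse)
open import Data.List.Properties using (unfold-reverse)
open import Function using (_∘_)
open import Relation.Binary.PropositionalEquality using (refl; sym; trans; cong; cong₂; module ≡-Reasoning)

suc-/2≤ : ∀ m → suc m / 2 ≤ m
suc-/2≤ m with m/n<m (suc m) 2 (s≤s (s≤s z≤n))
... | s≤s h = h

bitsLE-fuel : ∀ f g m → m ≤ f → m ≤ g → bitsLE f m ≡ bitsLE g m
bitsLE-fuel zero    zero    zero    _       _       = refl
bitsLE-fuel zero    (suc g) zero    _       _       = refl
bitsLE-fuel (suc f) zero    zero    _       _       = refl
bitsLE-fuel (suc f) (suc g) zero    _       _       = refl
bitsLE-fuel (suc f) (suc g) (suc m) (s≤s p) (s≤s q) =
  cong (((suc m % 2) ≡ᵇ 1) ∷_)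
    (bitsLE-fuel f g (suc m / 2) (≤-trans (suc-/2≤ m) p) (≤-trans (suc-/2≤ m) q))

binary-suc : ∀ m → binary (suc m) ≡ binary (suc m / 2) ++ [ (suc m % 2) ≡ᵇ 1 ]
binary-suc m = begin
    reverse (b ∷ bitsLE m (suc m / 2))
  ≡⟨ cong (reverse ∘ (b ∷_)) (bitsLE-fuel m (suc m / 2) (suc m / 2) (suc-/2≤ m) ≤-refl) ⟩
    reverse (b ∷ bitsLE (suc m / 2) (suc m / 2))
  ≡⟨ unfold-reverse b (bitsLE (suc m / 2) (suc m / 2)) ⟩
    binary (suc m / 2) ++ [ b ]
  ∎
  where
  open ≡-Reasoning
  b : Bool
  b = (suc m % 2) ≡ᵇ 1

binary-2*suc : ∀ k → binary (2 * suc k) ≡ binary (suc k) ++ [ false ]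
binary-2*suc k = trans (binary-suc (k + suc (k + 0)))
  (cong₂ (λ n r → binary n ++ [ r ≡ᵇ 1 ])
    (trans (cong (_/ 2) (*-comm 2 (suc k))) (m*n/n≡m (suc k) 2))
    (trans (cong (_% 2) (*-comm 2 (suc k))) (m*n%n≡0 (suc k) 2)))

binary-2*+1 : ∀ k → binary (2 * k + 1) ≡ binary k ++ [ true ]
binary-2*+1 k = begin
    binary (2 * k + 1)
  ≡⟨ cong binary (trans (+-comm (2 * k) 1) (cong suc (*-comm 2 k))) ⟩
    binary (suc (k * 2))
  ≡⟨ binary-suc (k * 2) ⟩
    binary (suc (k * 2) / 2) ++ [ (suc (k * 2) % 2) ≡ᵇ 1 ]
  ≡⟨ cong₂ (λ n r → binary n ++ [ r ≡ᵇ 1 ])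
       (trans (+-distrib-/-∣ʳ 1 {k * 2} {2} (divides-refl k)) (m*n/n≡m k 2))
       ([m+kn]%n≡m%n 1 k 2) ⟩
    binary k ++ [ true ]
  ∎
  where open ≡-Reasoning

contAux-suc≡contAux-1 : ∀ p q j → contAux p q [ suc j ] ≡ contAux p q (j ∷ 1 ∷ [])
contAux-suc≡contAux-1 = ring-identity
  where
  ring-identity : ∀ p q j → suc j * p + q ≡ 1 * (j * p + q) + p
  ring-identity = solve-∀

==-not : ∀ c b → (c == not b) ≡ not (c == b)
==-not true  b     = refl
==-not false true  = refl
==-not false false = refl

contAux-runsAux-flip-last : ∀ p q c j xs b →
  contAux p q (runsAux c j (xs ++ [ b ])) ≡ contAux p q (runsAux c j (xs ++ [ not b ]))
contAux-runsAux-flip-last p q c j [] b rewrite ==-not c b with c == b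
... | true  = contAux-suc≡contAux-1 p q j
... | false = sym (contAux-suc≡contAux-1 p q j)
contAux-runsAux-flip-last p q c j (x ∷ xs) b with c == x
... | true  = contAux-runsAux-flip-last p q c (suc j) xs b
... | false = contAux-runsAux-flip-last (j * p + q) p x 1 xs b

continuant-runLengths-flip-last : ∀ xs b →
  continuant (runLengths (xs ++ [ b ])) ≡ continuant (runLengths (xs ++ [ not b ]))
continuant-runLengths-flip-last []       b = refl
continuant-runLengths-flip-last (x ∷ xs) b = contAux-runsAux-flip-last 1 0 x 1 xs b

lemma3 : (k : ℕ) →
    continuant (runLengths (binary (2 * k))) ≡ continuant (runLengths (binary (2 * k + 1)))
lemma3 zero    = refl
lemma3 (suc k) = begin
    K (binary (2 * suc k))            ≡⟨ cong K (binary-2*suc k) ⟩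
    K (binary (suc k) ++ [ false ])   ≡⟨ continuant-runLengths-flip-last (binary (suc k)) false ⟩
    K (binary (suc k) ++ [ true ])    ≡⟨ cong K (sym (binary-2*+1 (suc k))) ⟩
    K (binary (2 * suc k + 1))        ∎
  where
  open ≡-Reasoning
  K : List Bool → ℕ
  K = continuant ∘ runLengths
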